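{- For any integer $n\geqslant 0$, $$\sum_{k=0}^{n}q^{k-1}b_k(q)\,b_{n-k}(q)=-[n-1]_q\,b_n(q)-[n-2]_q\,b_{n-1}(q),$$ where $b_k(q)=0$ for $k<0$.
   Context: Let $q$ be an indeterminate. For any integer $n$ (possibly negative or zero), let $[n]_q=\frac{1-q^{n}}{1-q}$ (so e.g. $[-1]_q=-q^{ -1}$, $[0]_q=0$, $[1]_q=1$). Define the $q$-logarithm as the (formal) power series $\log_q(1+t)=\sum_{n=1}^{\infty}\frac{(-1)^{n-1}t^n}{[n]_q}$. The $q$-Bernoulli numbers of the second kind $b_n(q)$ are defined by $\sum_{n=0}^\infty b_n(q)t^n=\frac{t}{\log_q(1+t)}$, and one sets $b_k(q)=0$ for $k<0$. -}

module Defs where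

open import Level using (Level)
open import Algebra.Bundles using (CommutativeRing)
open import Data.Nat using (ℕ; zero; suc)
open import Data.Integer using (ℤ; +_; -[1+_])
open import Data.List using (List; []; _∷_)

-- Everything is developed over an arbitrary commutative ring R together with
-- an element q, a chosen inverse qinv of q, and chosen inverses of the
-- q-integers [m+1]_q.  (Taking R = ℚ(q) recovers the paper's setting.)
module QBernoulli {c ℓ : Level} (R : CommutativeRing c ℓ)
  (q qinv : CommutativeRing.Carrier R)
  (inv : ℕ → CommutativeRing.Carrier R)   -- inv m is the inverse of [suc m]_q
  where
  open CommutativeRing R

  pow : Carrier → ℕ → Carrier
  pow x zero = 1#
  pow x (suc n) = x * pow x n

  sumBelow : (ℕ → Carrier) → ℕ → Carrier
  sumBelow f zero = 0#
  sumBelow f (suc m) = sumBelow f m + f m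

  sumTo : (ℕ → Carrier) → ℕ → Carrier
  sumTo f n = sumBelow f (suc n)

  qnat : ℕ → Carrier
  qnat m = sumBelow (pow q) m

  qpowℤ : ℤ → Carrier
  qpowℤ (+ m) = pow q m
  qpowℤ -[1+ m ] = pow qinv (suc m)

  -- [n]_q = (1 - q^n)/(1 - q) for any integer n; for n = -m, [-m]_q = -q^{-m}[m]_q
  qint : ℤ → Carrier
  qint (+ m) = qnat m
  qint -[1+ m ] = - (pow qinv (suc m) * qnat (suc m))

  sign : ℕ → Carrier
  sign zero = 1#
  sign (suc m) = - (sign m)

  -- Coefficient comparison in (Σ b_n t^n) · log_q(1+t)/t = 1, where
  -- log_q(1+t)/t = Σ_{m≥0} (-1)^m t^m / [m+1]_q :
  --   b_0 = 1,  b_{n} = - Σ_{m=1}^{n} (-1)^m b_{n-m} / [m+1]_q  (n ≥ 1).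
  -- bList n = b_n ∷ b_{n-1} ∷ ... ∷ b_0.
  step : ℕ → List Carrier → Carrier
  step m [] = 0#
  step m (b ∷ bs) = sign m * b * inv m + step (suc m) bs

  bList : ℕ → List Carrier
  bList zero = 1# ∷ []
  bList (suc n) = (- step 1 (bList n)) ∷ bList n

  head0 : List Carrier → Carrier
  head0 [] = 0#
  head0 (x ∷ _) = x

  b : ℕ → Carrier
  b n = head0 (bList n)

  bℤ : ℤ → Carrier
  bℤ (+ n) = b n
  bℤ -[1+ _ ] = 0#

module Submission where

-- Work with formal power series (coefficient sequences) over R.  Write
-- ℓ = log_q(1+t)/t, so that b = Σ b_n t^n is characterised by ℓ · b = 1, and
-- use two operators: σ f (t) = f (q t), a ring endomorphism, and the
-- q-derivation N f = t D_q f with coefficients [n]_q f_n, which satisfies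
-- N (f g) = N f · g + σ f · N g.  Applying σ and N to ℓ · b = 1 gives
--   (σ b · b) · σ ℓ = b   and   (σ b · b) · N ℓ = - N b,
-- and since σ ℓ + N ℓ = Σ (-1)^n t^n = 1/(1+t) this yields
--   σ b · b = (1 + t)(b - N b).
-- The left side of the theorem is q^{-1} times the n-th coefficient of σ b · b;
-- the n-th coefficient of the right side, divided by q, is its right side.

open import Defs
open import Level using (Level; 0ℓ)
open import Algebra.Bundles using (CommutativeRing; RawRing)
open import Algebra.Solver.Ring.AlmostCommutativeRing using (fromCommutativeRing; _-Raw-AlmostCommutative⟶_)
open import Data.Nat as ℕ using (ℕ; zero; suc)
open import Data.Nat.Properties as ℕ using ()
open import Data.Integer using (+_; -[1+_]) renaming (_-_ to _⊖ℤ_)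
open import Data.Integer.Properties as ℤ using ()
open import Data.Product using (_,_) renaming (_×_ to _⊗_)
open import Data.Maybe using (Maybe; just; nothing)
open import Relation.Binary.PropositionalEquality as ≡ using (_≡_)
open import Relation.Nullary using (yes; no)
open import Relation.Binary.Bundles using (Setoid)
import Relation.Binary.Reasoning.Setoid as ≈-Reasoning

-- A ring solver for an arbitrary commutative ring R whose coefficients are
-- the integers, represented as formal differences (a , b) ↦ a - b of naturals.
-- Integer coefficients let the solver cancel x - x by computation, which a
-- solver with coefficients in the abstract ring R itself cannot do.
module IntegerCoefficientSolver {c ℓ : Level} (R : CommutativeRing c ℓ) where
  open CommutativeRing R
  open import Algebra.Properties.Ring ring
    using (-‿distribˡ-*; -‿distribʳ-*; -‿involutive; -‿+-comm; -0#≈0#; ⁻¹-anti-homo‿-)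
  open import Algebra.Properties.Semiring.Mult.TCOptimised semiring using (_×_; ×-homo-+; ×1-homo-*)
  open ≈-Reasoning setoid
  open import Algebra.Solver.CommutativeMonoid +-commutativeMonoid using (_⊕_; _⊜_) renaming (solve to +-solve)

  Diff : RawRing 0ℓ 0ℓ
  Diff = record
    { Carrier = ℕ ⊗ ℕ ; _≈_ = _≡_
    ; _+_ = λ { (a , b) (c , d) → a ℕ.+ c , b ℕ.+ d }
    ; _*_ = λ { (a , b) (c , d) → a ℕ.* c ℕ.+ b ℕ.* d , a ℕ.* d ℕ.+ b ℕ.* c }
    ; -_ = λ { (a , b) → b , a }
    ; 0# = 0 , 0 ; 1# = 1 , 0 }

  -- interpretation in R; the case split makes the constants (1 , 0) and (0 , 0)
  -- evaluate to 1# and 0# by computation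
  ⟦_⟧ᶜ : ℕ ⊗ ℕ → Carrier
  ⟦ a , zero ⟧ᶜ = a × 1#
  ⟦ a , suc b ⟧ᶜ = a × 1# - suc b × 1#

  ⟦⟧ᶜ-diff : ∀ a b → ⟦ a , b ⟧ᶜ ≈ a × 1# - b × 1#
  ⟦⟧ᶜ-diff a zero = sym (trans (+-congˡ -0#≈0#) (+-identityʳ _))
  ⟦⟧ᶜ-diff a (suc b) = refl

  sub-+ : ∀ x y z w → (x - y) + (z - w) ≈ (x + z) - (y + w)
  sub-+ x y z w = begin
    (x - y) + (z - w)     ≈⟨ +-solve 4 (λ x y z w → (x ⊕ y) ⊕ (z ⊕ w) ⊜ (x ⊕ z) ⊕ (y ⊕ w)) refl x (- y) z (- w) ⟩
    (x + z) + (- y + - w) ≈⟨ +-congˡ (-‿+-comm y w) ⟩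
    (x + z) - (y + w)     ∎

  sub-* : ∀ x y z w → (x - y) * (z - w) ≈ (x * z + y * w) - (x * w + y * z)
  sub-* x y z w = begin
    (x - y) * (z - w)
      ≈⟨ trans (distribʳ _ _ _) (+-cong (distribˡ _ _ _) (distribˡ _ _ _)) ⟩
    (x * z + x * - w) + (- y * z + - y * - w)
      ≈⟨ +-cong (+-congˡ (sym (-‿distribʳ-* x w)))
                (+-cong (sym (-‿distribˡ-* y z)) neg-neg) ⟩
    (x * z - x * w) + (- (y * z) + y * w)
      ≈⟨ +-solve 4 (λ a b c d → (a ⊕ b) ⊕ (c ⊕ d) ⊜ (a ⊕ d) ⊕ (b ⊕ c)) refl (x * z) (- (x * w)) (- (y * z)) (y * w) ⟩
    (x * z + y * w) + (- (x * w) + - (y * z))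
      ≈⟨ +-congˡ (-‿+-comm (x * w) (y * z)) ⟩
    (x * z + y * w) - (x * w + y * z) ∎
    where
    neg-neg : - y * - w ≈ y * w
    neg-neg = trans (sym (-‿distribˡ-* y (- w)))
                    (trans (-‿cong (sym (-‿distribʳ-* y w))) (-‿involutive _))

  sub-cong : ∀ x y z w → x + w ≈ z + y → x - y ≈ z - w
  sub-cong x y z w e = begin
    x - y                     ≈⟨ cancel x y w ⟨
    (x + w) - (y + w)         ≈⟨ +-congʳ e ⟩
    (z + y) - (y + w)         ≈⟨ +-congˡ (-‿cong (+-comm y w)) ⟩
    (z + y) - (w + y)         ≈⟨ cancel z w y ⟩
    z - w                     ∎
    where
    cancel : ∀ x y w → (x + w) - (y + w) ≈ x - y
    cancel x y w = begin
      (x + w) - (y + w)       ≈⟨ +-congˡ (sym (-‿+-comm y w)) ⟩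
      (x + w) + (- y + - w)   ≈⟨ +-solve 4 (λ a b c d → (a ⊕ b) ⊕ (c ⊕ d) ⊜ (a ⊕ c) ⊕ (b ⊕ d)) refl x w (- y) (- w) ⟩
      (x - y) + (w - w)       ≈⟨ +-congˡ (-‿inverseʳ w) ⟩
      (x - y) + 0#            ≈⟨ +-identityʳ _ ⟩
      x - y                   ∎

  +-homoᶜ : ∀ a b c d → ⟦ a ℕ.+ c , b ℕ.+ d ⟧ᶜ ≈ ⟦ a , b ⟧ᶜ + ⟦ c , d ⟧ᶜ
  +-homoᶜ a b c d = begin
    ⟦ a ℕ.+ c , b ℕ.+ d ⟧ᶜ                 ≈⟨ ⟦⟧ᶜ-diff (a ℕ.+ c) (b ℕ.+ d) ⟩
    (a ℕ.+ c) × 1# - (b ℕ.+ d) × 1#        ≈⟨ +-cong (×-homo-+ 1# a c) (-‿cong (×-homo-+ 1# b d)) ⟩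
    (a × 1# + c × 1#) - (b × 1# + d × 1#)  ≈⟨ sub-+ _ _ _ _ ⟨
    (a × 1# - b × 1#) + (c × 1# - d × 1#)  ≈⟨ +-cong (⟦⟧ᶜ-diff a b) (⟦⟧ᶜ-diff c d) ⟨
    ⟦ a , b ⟧ᶜ + ⟦ c , d ⟧ᶜ                 ∎

  *-homoᶜ : ∀ a b c d → ⟦ a ℕ.* c ℕ.+ b ℕ.* d , a ℕ.* d ℕ.+ b ℕ.* c ⟧ᶜ ≈ ⟦ a , b ⟧ᶜ * ⟦ c , d ⟧ᶜ
  *-homoᶜ a b c d = begin
    ⟦ a ℕ.* c ℕ.+ b ℕ.* d , a ℕ.* d ℕ.+ b ℕ.* c ⟧ᶜ
      ≈⟨ ⟦⟧ᶜ-diff (a ℕ.* c ℕ.+ b ℕ.* d) (a ℕ.* d ℕ.+ b ℕ.* c) ⟩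
    (a ℕ.* c ℕ.+ b ℕ.* d) × 1# - (a ℕ.* d ℕ.+ b ℕ.* c) × 1#
      ≈⟨ +-cong (mul-sum a c b d) (-‿cong (mul-sum a d b c)) ⟩
    (A * C + B * D) - (A * D + B * C)
      ≈⟨ sub-* A B C D ⟨
    (A - B) * (C - D)
      ≈⟨ *-cong (⟦⟧ᶜ-diff a b) (⟦⟧ᶜ-diff c d) ⟨
    ⟦ a , b ⟧ᶜ * ⟦ c , d ⟧ᶜ ∎
    where
    A = a × 1#; B = b × 1#; C = c × 1#; D = d × 1#
    mul-sum : ∀ a c b d → (a ℕ.* c ℕ.+ b ℕ.* d) × 1# ≈ (a × 1#) * (c × 1#) + (b × 1#) * (d × 1#)
    mul-sum a c b d = trans (×-homo-+ 1# (a ℕ.* c) (b ℕ.* d)) (+-cong (×1-homo-* a c) (×1-homo-* b d))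

  -‿homoᶜ : ∀ a b → ⟦ b , a ⟧ᶜ ≈ - ⟦ a , b ⟧ᶜ
  -‿homoᶜ a b = trans (⟦⟧ᶜ-diff b a) (trans (sym (⁻¹-anti-homo‿- _ _)) (-‿cong (sym (⟦⟧ᶜ-diff a b))))

  morphism : Diff -Raw-AlmostCommutative⟶ fromCommutativeRing R
  morphism = record
    { ⟦_⟧ = ⟦_⟧ᶜ
    ; +-homo = λ { (a , b) (c , d) → +-homoᶜ a b c d }
    ; *-homo = λ { (a , b) (c , d) → *-homoᶜ a b c d }
    ; -‿homo = λ { (a , b) → -‿homoᶜ a b }
    ; 0-homo = refl
    ; 1-homo = refl
    }

  _≟ᶜ_ : ∀ x y → Maybe (⟦ x ⟧ᶜ ≈ ⟦ y ⟧ᶜ)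
  (a , b) ≟ᶜ (c , d) with a ℕ.+ d ℕ.≟ c ℕ.+ b
  ... | no _ = nothing
  ... | yes a+d≡c+b = just (begin
    ⟦ a , b ⟧ᶜ          ≈⟨ ⟦⟧ᶜ-diff a b ⟩
    a × 1# - b × 1#     ≈⟨ sub-cong _ _ _ _ sums ⟩
    c × 1# - d × 1#     ≈⟨ ⟦⟧ᶜ-diff c d ⟨
    ⟦ c , d ⟧ᶜ          ∎)
    where
    sums : a × 1# + d × 1# ≈ c × 1# + b × 1#
    sums = trans (sym (×-homo-+ 1# a d)) (trans (reflexive (≡.cong (_× 1#) a+d≡c+b)) (×-homo-+ 1# c b))

  open import Algebra.Solver.Ring Diff (fromCommutativeRing R) morphism _≟ᶜ_ public
    using (solve; _:+_; _:*_; :-_; _:-_; _:=_; con)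

module PowerSeries {c ℓ : Level} (R : CommutativeRing c ℓ) where
  open CommutativeRing R
  open import Algebra.Properties.Ring ring using (-‿distribˡ-*)
  open IntegerCoefficientSolver R using (solve; _:+_; _:*_; :-_; _:=_)
  open ≈-Reasoning setoid

  Series : Set c
  Series = ℕ → Carrier

  infix 4 _≐_
  _≐_ : Series → Series → Set ℓ
  f ≐ g = ∀ n → f n ≈ g n

  ≐-setoid : Setoid c ℓ
  ≐-setoid = record
    { Carrier = Series ; _≈_ = _≐_
    ; isEquivalence = record
      { refl = λ n → refl ; sym = λ e n → sym (e n) ; trans = λ e e′ n → trans (e n) (e′ n) } }

  shift : Series → Series
  shift f n = f (suc n)

  infixl 6 _⊞_
  _⊞_ : Series → Series → Series
  (f ⊞ g) n = f n + g n

  ⊟_ : Series → Series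
  (⊟ f) n = - f n

  infixr 8 _•_
  _•_ : Carrier → Series → Series
  (a • f) n = a * f n

  δ : Series
  δ zero = 1#
  δ (suc n) = 0#

  infixl 7 _⋆_
  _⋆_ : Series → Series → Series
  (f ⋆ g) zero = f 0 * g 0
  (f ⋆ g) (suc n) = f 0 * g (suc n) + (shift f ⋆ g) n

  ⋆-cong : ∀ {f f′ g g′} → f ≐ f′ → g ≐ g′ → f ⋆ g ≐ f′ ⋆ g′
  ⋆-cong f≐f′ g≐g′ zero = *-cong (f≐f′ 0) (g≐g′ 0)
  ⋆-cong f≐f′ g≐g′ (suc n) = +-cong (*-cong (f≐f′ 0) (g≐g′ (suc n))) (⋆-cong (λ m → f≐f′ (suc m)) g≐g′ n)

  ⋆-congˡ : ∀ {f f′} g → f ≐ f′ → f ⋆ g ≐ f′ ⋆ g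
  ⋆-congˡ g f≐f′ = ⋆-cong f≐f′ (λ n → refl)

  ⋆-congʳ : ∀ f {g g′} → g ≐ g′ → f ⋆ g ≐ f ⋆ g′
  ⋆-congʳ f g≐g′ = ⋆-cong (λ n → refl) g≐g′

  ⋆-shiftʳ : ∀ f g n → (f ⋆ g) (suc n) ≈ (f ⋆ shift g) n + f (suc n) * g 0
  ⋆-shiftʳ f g zero = refl
  ⋆-shiftʳ f g (suc n) = begin
    f 0 * g (suc (suc n)) + (shift f ⋆ g) (suc n)
      ≈⟨ +-congˡ (⋆-shiftʳ (shift f) g n) ⟩
    f 0 * g (suc (suc n)) + ((shift f ⋆ shift g) n + f (suc (suc n)) * g 0)
      ≈⟨ +-assoc _ _ _ ⟨
    (f ⋆ shift g) (suc n) + f (suc (suc n)) * g 0 ∎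

  ⋆-comm : ∀ f g → f ⋆ g ≐ g ⋆ f
  ⋆-comm f g zero = *-comm _ _
  ⋆-comm f g (suc n) = begin
    f 0 * g (suc n) + (shift f ⋆ g) n  ≈⟨ +-cong (*-comm _ _) (⋆-comm (shift f) g n) ⟩
    g (suc n) * f 0 + (g ⋆ shift f) n  ≈⟨ +-comm _ _ ⟩
    (g ⋆ shift f) n + g (suc n) * f 0  ≈⟨ ⋆-shiftʳ g f n ⟨
    (g ⋆ f) (suc n)                    ∎

  ⋆-distribʳ : ∀ f g h → (f ⊞ g) ⋆ h ≐ f ⋆ h ⊞ g ⋆ h
  ⋆-distribʳ f g h zero = distribʳ _ _ _
  ⋆-distribʳ f g h (suc n) = begin
    (f 0 + g 0) * h (suc n) + ((shift f ⊞ shift g) ⋆ h) n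
      ≈⟨ +-cong (distribʳ _ _ _) (⋆-distribʳ (shift f) (shift g) h n) ⟩
    (f 0 * h (suc n) + g 0 * h (suc n)) + ((shift f ⋆ h) n + (shift g ⋆ h) n)
      ≈⟨ solve 4 (λ a b c d → (a :+ b) :+ (c :+ d) := (a :+ c) :+ (b :+ d)) refl _ _ _ _ ⟩
    (f ⋆ h ⊞ g ⋆ h) (suc n) ∎

  ⋆-distribˡ : ∀ f g h → f ⋆ (g ⊞ h) ≐ f ⋆ g ⊞ f ⋆ h
  ⋆-distribˡ f g h n = begin
    (f ⋆ (g ⊞ h)) n        ≈⟨ ⋆-comm f (g ⊞ h) n ⟩
    ((g ⊞ h) ⋆ f) n        ≈⟨ ⋆-distribʳ g h f n ⟩
    (g ⋆ f) n + (h ⋆ f) n  ≈⟨ +-cong (⋆-comm g f n) (⋆-comm h f n) ⟩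
    (f ⋆ g ⊞ f ⋆ h) n      ∎

  ⋆-scaleˡ : ∀ a f g → (a • f) ⋆ g ≐ a • (f ⋆ g)
  ⋆-scaleˡ a f g zero = *-assoc _ _ _
  ⋆-scaleˡ a f g (suc n) = begin
    (a * f 0) * g (suc n) + (a • shift f ⋆ g) n   ≈⟨ +-cong (*-assoc _ _ _) (⋆-scaleˡ a (shift f) g n) ⟩
    a * (f 0 * g (suc n)) + a * (shift f ⋆ g) n   ≈⟨ distribˡ _ _ _ ⟨
    a * (f ⋆ g) (suc n)                           ∎

  ⋆-negˡ : ∀ f g → (⊟ f) ⋆ g ≐ ⊟ (f ⋆ g)
  ⋆-negˡ f g zero = sym (-‿distribˡ-* _ _)
  ⋆-negˡ f g (suc n) = begin
    - f 0 * g (suc n) + ((⊟ shift f) ⋆ g) n   ≈⟨ +-congˡ (⋆-negˡ (shift f) g n) ⟩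
    - f 0 * g (suc n) + - (shift f ⋆ g) n     ≈⟨ solve 3 (λ a b c → (:- a) :* b :+ (:- c) := :- (a :* b :+ c)) refl _ _ _ ⟩
    - (f ⋆ g) (suc n)                         ∎

  ⋆-zeroˡ : ∀ {f} g → (∀ n → f n ≈ 0#) → ∀ n → (f ⋆ g) n ≈ 0#
  ⋆-zeroˡ g f≈0 zero = trans (*-congʳ (f≈0 0)) (zeroˡ _)
  ⋆-zeroˡ g f≈0 (suc n) =
    trans (+-cong (trans (*-congʳ (f≈0 0)) (zeroˡ _)) (⋆-zeroˡ g (λ m → f≈0 (suc m)) n)) (+-identityʳ 0#)

  ⋆-assoc : ∀ f g h → (f ⋆ g) ⋆ h ≐ f ⋆ (g ⋆ h)
  ⋆-assoc f g h zero = *-assoc _ _ _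
  ⋆-assoc f g h (suc n) = begin
    (f 0 * g 0) * h (suc n) + (shift (f ⋆ g) ⋆ h) n
      ≈⟨ +-congˡ (⋆-distribʳ (f 0 • shift g) (shift f ⋆ g) h n) ⟩
    (f 0 * g 0) * h (suc n) + (((f 0 • shift g) ⋆ h) n + ((shift f ⋆ g) ⋆ h) n)
      ≈⟨ +-congˡ (+-cong (⋆-scaleˡ (f 0) (shift g) h n) (⋆-assoc (shift f) g h n)) ⟩
    (f 0 * g 0) * h (suc n) + (f 0 * (shift g ⋆ h) n + (shift f ⋆ (g ⋆ h)) n)
      ≈⟨ solve 5 (λ a b c d e → (a :* b) :* c :+ (a :* d :+ e) := a :* (b :* c :+ d) :+ e) refl _ _ _ _ _ ⟩
    (f ⋆ (g ⋆ h)) (suc n) ∎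

  ⋆-identityˡ : ∀ g → δ ⋆ g ≐ g
  ⋆-identityˡ g zero = *-identityˡ _
  ⋆-identityˡ g (suc n) = trans (+-cong (*-identityˡ _) (⋆-zeroˡ g (λ m → refl) n)) (+-identityʳ _)

  ⋆-identityʳ : ∀ g → g ⋆ δ ≐ g
  ⋆-identityʳ g n = trans (⋆-comm g δ n) (⋆-identityˡ g n)

module QOperators {c ℓ : Level} (R : CommutativeRing c ℓ)
  (q qinv : CommutativeRing.Carrier R) (inv : ℕ → CommutativeRing.Carrier R) where
  open CommutativeRing R
  open QBernoulli R q qinv inv
  open PowerSeries R
  open IntegerCoefficientSolver R using (solve; _:+_; _:*_; _:=_; con)
  open ≈-Reasoning setoid

  σ : Series → Series
  σ f n = pow q n * f n

  σ-cong : ∀ {f g} → f ≐ g → σ f ≐ σ g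
  σ-cong f≐g n = *-congˡ (f≐g n)

  σ-δ : σ δ ≐ δ
  σ-δ zero = *-identityʳ _
  σ-δ (suc n) = zeroʳ _

  -- σ is multiplicative (q^n = q^k q^{n-k})
  σ-⋆ : ∀ f g → σ (f ⋆ g) ≐ σ f ⋆ σ g
  σ-⋆ f g zero = solve 2 (λ a b → con (1 , 0) :* (a :* b) := (con (1 , 0) :* a) :* (con (1 , 0) :* b)) refl _ _
  σ-⋆ f g (suc n) = begin
    (q * pow q n) * (f 0 * g (suc n) + (shift f ⋆ g) n)
      ≈⟨ solve 5 (λ q Q a G C → (q :* Q) :* (a :* G :+ C) := (con (1 , 0) :* a) :* ((q :* Q) :* G) :+ q :* (Q :* C)) refl _ _ _ _ _ ⟩
    σ f 0 * σ g (suc n) + q * σ (shift f ⋆ g) n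
      ≈⟨ +-congˡ (*-congˡ (σ-⋆ (shift f) g n)) ⟩
    σ f 0 * σ g (suc n) + q * (σ (shift f) ⋆ σ g) n
      ≈⟨ +-congˡ (⋆-scaleˡ q (σ (shift f)) (σ g) n) ⟨
    σ f 0 * σ g (suc n) + ((q • σ (shift f)) ⋆ σ g) n
      ≈⟨ +-congˡ (⋆-congˡ (σ g) (λ m → sym (*-assoc _ _ _)) n) ⟩
    (σ f ⋆ σ g) (suc n) ∎

  qnat-suc : ∀ n → qnat (suc n) ≈ 1# + q * qnat n
  qnat-suc zero = solve 1 (λ q → con (0 , 0) :+ con (1 , 0) := con (1 , 0) :+ q :* con (0 , 0)) refl q
  qnat-suc (suc n) = begin
    qnat (suc n) + q * pow q n       ≈⟨ +-congʳ (qnat-suc n) ⟩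
    (1# + q * qnat n) + q * pow q n  ≈⟨ solve 3 (λ q K Q → (con (1 , 0) :+ q :* K) :+ q :* Q := con (1 , 0) :+ q :* (K :+ Q)) refl q (qnat n) (pow q n) ⟩
    1# + q * qnat (suc n)            ∎

  N : Series → Series
  N f n = qnat n * f n

  N-shift : ∀ f → shift (N f) ≐ shift f ⊞ q • N (shift f)
  N-shift f n = trans (*-congʳ (qnat-suc n)) (solve 3 (λ q K F → (con (1 , 0) :+ q :* K) :* F := F :+ q :* (K :* F)) refl q (qnat n) (f (suc n)))

  N-⋆ : ∀ f g → N (f ⋆ g) ≐ N f ⋆ g ⊞ σ f ⋆ N g
  N-⋆ f g zero = solve 2 (λ a b → con (0 , 0) :* (a :* b) := (con (0 , 0) :* a) :* b :+ (con (1 , 0) :* a) :* (con (0 , 0) :* b)) refl (f 0) (g 0)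
  N-⋆ f g (suc n) = begin
    qnat (suc n) * (f 0 * g (suc n) + A)
      ≈⟨ split ⟩
    f 0 * N g (suc n) + (A + q * N (shift f ⋆ g) n)
      ≈⟨ +-congˡ (+-congˡ (*-congˡ (N-⋆ (shift f) g n))) ⟩
    f 0 * N g (suc n) + (A + q * ((N (shift f) ⋆ g) n + (σ (shift f) ⋆ N g) n))
      ≈⟨ solve 7 (λ a g′ G A B C q → a :* G :+ (A :+ q :* (B :+ C))
                                     := (con (0 , 0) :* a) :* g′ :+ (A :+ q :* B) :+ ((con (1 , 0) :* a) :* G :+ q :* C))
                 refl (f 0) (g (suc n)) (N g (suc n)) A ((N (shift f) ⋆ g) n) ((σ (shift f) ⋆ N g) n) q ⟩
    (N f 0 * g (suc n) + (A + q * (N (shift f) ⋆ g) n)) + (σ f 0 * N g (suc n) + q * (σ (shift f) ⋆ N g) n)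
      ≈⟨ +-cong (+-congˡ shift-N) (+-congˡ shift-σ) ⟩
    (N f ⋆ g ⊞ σ f ⋆ N g) (suc n) ∎
    where
    A = (shift f ⋆ g) n

    split : qnat (suc n) * (f 0 * g (suc n) + A) ≈ f 0 * N g (suc n) + (A + q * N (shift f ⋆ g) n)
    split = begin
      qnat (suc n) * (f 0 * g (suc n) + A)
        ≈⟨ solve 4 (λ K′ a G A → K′ :* (a :* G :+ A) := a :* (K′ :* G) :+ K′ :* A) refl (qnat (suc n)) (f 0) (g (suc n)) A ⟩
      f 0 * N g (suc n) + qnat (suc n) * A
        ≈⟨ +-congˡ (*-congʳ (qnat-suc n)) ⟩
      f 0 * N g (suc n) + (1# + q * qnat n) * A
        ≈⟨ +-congˡ (solve 3 (λ q K A → (con (1 , 0) :+ q :* K) :* A := A :+ q :* (K :* A)) refl q (qnat n) A) ⟩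
      f 0 * N g (suc n) + (A + q * N (shift f ⋆ g) n) ∎

    shift-N : A + q * (N (shift f) ⋆ g) n ≈ (shift (N f) ⋆ g) n
    shift-N = begin
      A + q * (N (shift f) ⋆ g) n              ≈⟨ +-congˡ (⋆-scaleˡ q (N (shift f)) g n) ⟨
      A + (q • N (shift f) ⋆ g) n              ≈⟨ ⋆-distribʳ (shift f) (q • N (shift f)) g n ⟨
      ((shift f ⊞ q • N (shift f)) ⋆ g) n      ≈⟨ ⋆-congˡ g (λ m → sym (N-shift f m)) n ⟩
      (shift (N f) ⋆ g) n                      ∎

    shift-σ : q * (σ (shift f) ⋆ N g) n ≈ (shift (σ f) ⋆ N g) n
    shift-σ = begin
      q * (σ (shift f) ⋆ N g) n                ≈⟨ ⋆-scaleˡ q (σ (shift f)) (N g) n ⟨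
      (q • σ (shift f) ⋆ N g) n                ≈⟨ ⋆-congˡ (N g) (λ m → sym (*-assoc _ _ _)) n ⟩
      (shift (σ f) ⋆ N g) n                    ∎

module FiniteSums {c ℓ : Level} (R : CommutativeRing c ℓ)
  (q qinv : CommutativeRing.Carrier R) (inv : ℕ → CommutativeRing.Carrier R) where
  open CommutativeRing R
  open QBernoulli R q qinv inv
  open PowerSeries R

  sumBelow-cong : ∀ {f g} m → (∀ k → k ℕ.< m → f k ≈ g k) → sumBelow f m ≈ sumBelow g m
  sumBelow-cong zero f≈g = refl
  sumBelow-cong (suc m) f≈g = +-cong (sumBelow-cong m (λ k k<m → f≈g k (ℕ.m<n⇒m<1+n k<m))) (f≈g m (ℕ.n<1+n m))

  sumBelow-scale : ∀ a f m → sumBelow (λ k → a * f k) m ≈ a * sumBelow f m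
  sumBelow-scale a f zero = sym (zeroʳ a)
  sumBelow-scale a f (suc m) = trans (+-congʳ (sumBelow-scale a f m)) (sym (distribˡ _ _ _))

  sumBelow-uncons : ∀ h m → sumBelow h (suc m) ≈ h 0 + sumBelow (λ k → h (suc k)) m
  sumBelow-uncons h zero = +-comm _ _
  sumBelow-uncons h (suc m) = trans (+-congʳ (sumBelow-uncons h m)) (+-assoc _ _ _)

  ⋆-as-sum : ∀ f g n → (f ⋆ g) n ≈ sumTo (λ k → f k * g (n ℕ.∸ k)) n
  ⋆-as-sum f g zero = sym (+-identityˡ _)
  ⋆-as-sum f g (suc n) =
    trans (+-congˡ (⋆-as-sum (shift f) g n)) (sym (sumBelow-uncons (λ k → f k * g (suc n ℕ.∸ k)) (suc n)))

module Bernoulli {c ℓ′ : Level} (R : CommutativeRing c ℓ′)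
  (q qinv : CommutativeRing.Carrier R) (inv : ℕ → CommutativeRing.Carrier R)
  (q*qinv≈1 : CommutativeRing._≈_ R (CommutativeRing._*_ R q qinv) (CommutativeRing.1# R))
  (inv-correct : ∀ m → CommutativeRing._≈_ R (CommutativeRing._*_ R (QBernoulli.qnat R q qinv inv (suc m)) (inv m)) (CommutativeRing.1# R))
  where
  open CommutativeRing R
  open QBernoulli R q qinv inv
  open PowerSeries R
  open QOperators R q qinv inv
  open FiniteSums R q qinv inv
  open IntegerCoefficientSolver R using (solve; _:+_; _:*_; :-_; _:-_; _:=_; con)
  open import Algebra.Properties.Ring ring using (+-inverseʳ-unique)
  open ≈-Reasoning setoid
  module S = ≈-Reasoning ≐-setoid

  -- coefficients of log_q(1+t)/t = Σ (-1)^m t^m / [m+1]_q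
  ℓ : Series
  ℓ m = sign m * inv m

  -- [1]_q = 1, so ℓ_0 = 1
  inv-0 : inv 0 ≈ 1#
  inv-0 = trans (solve 1 (λ x → x := (con (0 , 0) :+ con (1 , 0)) :* x) refl (inv 0)) (inv-correct 0)

  -- the recursion of Defs computes truncated products of a tail of ℓ with b:
  -- step m (bList n) = Σ_{i ≤ n} ℓ_{m+i} b_{n-i}
  step-as-⋆ : ∀ n m f → (∀ i → f i ≡ ℓ (m ℕ.+ i)) → step m (bList n) ≈ (f ⋆ b) n
  step-as-⋆ zero m f f≡ℓ = begin
    sign m * 1# * inv m + 0#  ≈⟨ solve 2 (λ s i → s :* con (1 , 0) :* i :+ con (0 , 0) := (s :* i) :* con (1 , 0)) refl (sign m) (inv m) ⟩
    ℓ m * 1#                  ≈⟨ *-congʳ (reflexive (≡.sym (≡.trans (f≡ℓ 0) (≡.cong ℓ (ℕ.+-identityʳ m))))) ⟩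
    f 0 * 1#                  ∎
  step-as-⋆ (suc n) m f f≡ℓ = begin
    sign m * b (suc n) * inv m + step (suc m) (bList n)
      ≈⟨ +-cong (solve 3 (λ s x i → s :* x :* i := (s :* i) :* x) refl (sign m) (b (suc n)) (inv m))
                (step-as-⋆ n (suc m) (shift f) (λ i → ≡.trans (f≡ℓ (suc i)) (≡.cong ℓ (ℕ.+-suc m i)))) ⟩
    ℓ m * b (suc n) + (shift f ⋆ b) n
      ≈⟨ +-congʳ (*-congʳ (reflexive (≡.sym (≡.trans (f≡ℓ 0) (≡.cong ℓ (ℕ.+-identityʳ m)))))) ⟩
    (f ⋆ b) (suc n) ∎

  ℓ⋆b : ℓ ⋆ b ≐ δ
  ℓ⋆b zero = trans (*-congʳ (*-congˡ inv-0)) (solve 0 (con (1 , 0) :* con (1 , 0) :* con (1 , 0) := con (1 , 0)) refl)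
  ℓ⋆b (suc n) = begin
    ℓ 0 * (- step 1 (bList n)) + (shift ℓ ⋆ b) n
      ≈⟨ +-congʳ (*-cong (*-congˡ inv-0) (-‿cong (step-as-⋆ n 1 (shift ℓ) (λ i → ≡.refl)))) ⟩
    (1# * 1#) * (- (shift ℓ ⋆ b) n) + (shift ℓ ⋆ b) n
      ≈⟨ solve 1 (λ y → (con (1 , 0) :* con (1 , 0)) :* (:- y) :+ y := con (0 , 0)) refl _ ⟩
    0# ∎

  -- the same, with the factors in the order needed for the q-Leibniz rule
  b⋆ℓ : b ⋆ ℓ ≐ δ
  b⋆ℓ n = trans (⋆-comm b ℓ n) (ℓ⋆b n)

  -- σ ℓ + N ℓ is the alternating series: q^m + [m]_q = [m+1]_q
  σℓ+Nℓ≈sign : ∀ m → (σ ℓ ⊞ N ℓ) m ≈ sign m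
  σℓ+Nℓ≈sign m = begin
    pow q m * (sign m * inv m) + qnat m * (sign m * inv m)
      ≈⟨ solve 4 (λ Q s i K → Q :* (s :* i) :+ K :* (s :* i) := s :* ((K :+ Q) :* i)) refl (pow q m) (sign m) (inv m) (qnat m) ⟩
    sign m * (qnat (suc m) * inv m)  ≈⟨ *-congˡ (inv-correct m) ⟩
    sign m * 1#                      ≈⟨ *-identityʳ _ ⟩
    sign m                           ∎

  T : Series
  T zero = 1#
  T (suc zero) = 1#
  T (suc (suc n)) = 0#

  shift-T : shift T ≐ δ
  shift-T zero = refl
  shift-T (suc n) = refl

  T⋆-suc : ∀ f n → (T ⋆ f) (suc n) ≈ f (suc n) + f n
  T⋆-suc f n = +-cong (*-identityˡ _) (trans (⋆-congˡ f shift-T n) (⋆-identityˡ f n))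

  T⋆sign : T ⋆ sign ≐ δ
  T⋆sign zero = *-identityˡ _
  T⋆sign (suc n) = trans (T⋆-suc sign n) (-‿inverseˡ _)

  X : Series
  X = σ b ⋆ b

  -- N applied to b ⋆ ℓ = 1 (the q-Leibniz rule, and N 1 = 0):
  -- σ b ⋆ N ℓ = - N b ⋆ ℓ
  σb⋆Nℓ : σ b ⋆ N ℓ ≐ ⊟ (N b ⋆ ℓ)
  σb⋆Nℓ n = +-inverseʳ-unique _ _ (begin
    (N b ⋆ ℓ ⊞ σ b ⋆ N ℓ) n      ≈⟨ N-⋆ b ℓ n ⟨
    qnat n * (b ⋆ ℓ) n           ≈⟨ *-congˡ (b⋆ℓ n) ⟩
    qnat n * δ n                 ≈⟨ N-δ n ⟩
    0#                           ∎)
    where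
    N-δ : ∀ n → qnat n * δ n ≈ 0#
    N-δ zero = zeroˡ _
    N-δ (suc n) = zeroʳ _

  X⋆Nℓ : X ⋆ N ℓ ≐ ⊟ (N b)
  X⋆Nℓ = S.begin
    σ b ⋆ b ⋆ N ℓ        S.≈⟨ ⋆-assoc (σ b) b (N ℓ) ⟩
    σ b ⋆ (b ⋆ N ℓ)      S.≈⟨ ⋆-congʳ (σ b) (⋆-comm b (N ℓ)) ⟩
    σ b ⋆ (N ℓ ⋆ b)      S.≈⟨ (λ n → sym (⋆-assoc (σ b) (N ℓ) b n)) ⟩
    σ b ⋆ N ℓ ⋆ b        S.≈⟨ ⋆-congˡ b σb⋆Nℓ ⟩
    (⊟ (N b ⋆ ℓ)) ⋆ b    S.≈⟨ ⋆-negˡ (N b ⋆ ℓ) b ⟩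
    ⊟ (N b ⋆ ℓ ⋆ b)      S.≈⟨ (λ n → -‿cong (⋆-assoc (N b) ℓ b n)) ⟩
    ⊟ (N b ⋆ (ℓ ⋆ b))    S.≈⟨ (λ n → -‿cong (⋆-congʳ (N b) ℓ⋆b n)) ⟩
    ⊟ (N b ⋆ δ)          S.≈⟨ (λ n → -‿cong (⋆-identityʳ (N b) n)) ⟩
    ⊟ (N b)              S.∎

  -- σ applied to b ⋆ ℓ = 1
  X⋆σℓ : X ⋆ σ ℓ ≐ b
  X⋆σℓ = S.begin
    σ b ⋆ b ⋆ σ ℓ        S.≈⟨ ⋆-congˡ (σ ℓ) (⋆-comm (σ b) b) ⟩
    b ⋆ σ b ⋆ σ ℓ        S.≈⟨ ⋆-assoc b (σ b) (σ ℓ) ⟩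
    b ⋆ (σ b ⋆ σ ℓ)      S.≈⟨ ⋆-congʳ b (λ n → sym (σ-⋆ b ℓ n)) ⟩
    b ⋆ σ (b ⋆ ℓ)        S.≈⟨ ⋆-congʳ b (σ-cong b⋆ℓ) ⟩
    b ⋆ σ δ              S.≈⟨ ⋆-congʳ b σ-δ ⟩
    b ⋆ δ                S.≈⟨ ⋆-identityʳ b ⟩
    b                    S.∎

  Y : Series
  Y = b ⊞ ⊟ (N b)

  X≐T⋆Y : X ≐ T ⋆ Y
  X≐T⋆Y = S.begin
    X                    S.≈⟨ (λ n → sym (⋆-identityʳ X n)) ⟩
    X ⋆ δ                S.≈⟨ ⋆-congʳ X (λ n → sym (T⋆sign n)) ⟩
    X ⋆ (T ⋆ sign)       S.≈⟨ (λ n → sym (⋆-assoc X T sign n)) ⟩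
    X ⋆ T ⋆ sign         S.≈⟨ ⋆-congˡ sign (⋆-comm X T) ⟩
    T ⋆ X ⋆ sign         S.≈⟨ ⋆-assoc T X sign ⟩
    T ⋆ (X ⋆ sign)       S.≈⟨ ⋆-congʳ T (⋆-congʳ X (λ n → sym (σℓ+Nℓ≈sign n))) ⟩
    T ⋆ (X ⋆ (σ ℓ ⊞ N ℓ)) S.≈⟨ ⋆-congʳ T (⋆-distribˡ X (σ ℓ) (N ℓ)) ⟩
    T ⋆ (X ⋆ σ ℓ ⊞ X ⋆ N ℓ) S.≈⟨ ⋆-congʳ T (λ n → +-cong (X⋆σℓ n) (X⋆Nℓ n)) ⟩
    T ⋆ Y                S.∎

  qpowℤ-pred : ∀ k → qpowℤ (+ k ⊖ℤ + 1) ≈ qinv * pow q k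
  qpowℤ-pred zero = refl
  qpowℤ-pred (suc k) = begin
    pow q k                  ≈⟨ *-identityˡ _ ⟨
    1# * pow q k             ≈⟨ *-congʳ q*qinv≈1 ⟨
    (q * qinv) * pow q k     ≈⟨ solve 3 (λ q i Q → (q :* i) :* Q := i :* (q :* Q)) refl q qinv (pow q k) ⟩
    qinv * pow q (suc k)     ∎

  lhs≈qinv*X : ∀ n → sumTo (λ k → qpowℤ (+ k ⊖ℤ + 1) * b k * bℤ (+ n ⊖ℤ + k)) n ≈ qinv * X n
  lhs≈qinv*X n = begin
    sumTo (λ k → qpowℤ (+ k ⊖ℤ + 1) * b k * bℤ (+ n ⊖ℤ + k)) n
      ≈⟨ sumBelow-cong (suc n) (λ k k<1+n → term k (ℕ.≤-pred k<1+n)) ⟩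
    sumTo (λ k → qinv * (σ b k * b (n ℕ.∸ k))) n
      ≈⟨ sumBelow-scale qinv _ (suc n) ⟩
    qinv * sumTo (λ k → σ b k * b (n ℕ.∸ k)) n
      ≈⟨ *-congˡ (⋆-as-sum (σ b) b n) ⟨
    qinv * X n ∎
    where
    term : ∀ k → k ℕ.≤ n → qpowℤ (+ k ⊖ℤ + 1) * b k * bℤ (+ n ⊖ℤ + k) ≈ qinv * (σ b k * b (n ℕ.∸ k))
    term k k≤n = begin
      qpowℤ (+ k ⊖ℤ + 1) * b k * bℤ (+ n ⊖ℤ + k)
        ≈⟨ *-cong (*-congʳ (qpowℤ-pred k)) (reflexive (≡.cong bℤ (≡.trans (ℤ.m-n≡m⊖n n k) (ℤ.⊖-≥ k≤n)))) ⟩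
      (qinv * pow q k) * b k * b (n ℕ.∸ k)
        ≈⟨ solve 4 (λ i Q x y → (i :* Q) :* x :* y := i :* ((Q :* x) :* y)) refl qinv (pow q k) (b k) (b (n ℕ.∸ k)) ⟩
      qinv * (σ b k * b (n ℕ.∸ k)) ∎

  suc-minus-one : ∀ m → + suc m ⊖ℤ + 1 ≡ + m
  suc-minus-one m = ℤ.⊖-≥ (ℕ.s≤s ℕ.z≤n)

  -- q^{-1} (b - N b)_n = - [n-1]_q b_n, using 1 - [n]_q = - q [n-1]_q
  qinv*Y : ∀ n → qinv * Y n ≈ - (qint (+ n ⊖ℤ + 1) * b n)
  qinv*Y zero = solve 2 (λ i y → i :* (y :+ (:- (con (0 , 0) :* y))) := :- ((:- ((i :* con (1 , 0)) :* (con (0 , 0) :+ con (1 , 0)))) :* y)) refl qinv (b 0)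
  qinv*Y (suc m) = begin
    qinv * (b (suc m) + - (qnat (suc m) * b (suc m)))
      ≈⟨ *-congˡ (+-congˡ (-‿cong (*-congʳ (qnat-suc m)))) ⟩
    qinv * (b (suc m) + - ((1# + q * qnat m) * b (suc m)))
      ≈⟨ solve 4 (λ i q K y → i :* (y :+ (:- ((con (1 , 0) :+ q :* K) :* y))) := (q :* i) :* (:- (K :* y))) refl qinv q (qnat m) (b (suc m)) ⟩
    (q * qinv) * - (qnat m * b (suc m))
      ≈⟨ trans (*-congʳ q*qinv≈1) (*-identityˡ _) ⟩
    - (qint (+ m) * b (suc m))
      ≈⟨ reflexive (≡.cong (λ i → - (qint i * b (suc m))) (suc-minus-one m)) ⟨
    - (qint (+ suc m ⊖ℤ + 1) * b (suc m)) ∎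

  qinv*T⋆Y : ∀ n → qinv * (T ⋆ Y) n ≈ (- (qint (+ n ⊖ℤ + 1) * b n)) - qint (+ n ⊖ℤ + 2) * bℤ (+ n ⊖ℤ + 1)
  qinv*T⋆Y zero = begin
    qinv * (1# * Y 0)                   ≈⟨ *-congˡ (*-identityˡ _) ⟩
    qinv * Y 0                          ≈⟨ qinv*Y 0 ⟩
    - (qint -[1+ 0 ] * b 0)             ≈⟨ solve 2 (λ a w → a := a :- w :* con (0 , 0)) refl _ _ ⟩
    (- (qint -[1+ 0 ] * b 0)) - qint -[1+ 1 ] * 0# ∎
  qinv*T⋆Y (suc m) = begin
    qinv * (T ⋆ Y) (suc m)              ≈⟨ *-congˡ (T⋆-suc Y m) ⟩
    qinv * (Y (suc m) + Y m)            ≈⟨ distribˡ _ _ _ ⟩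
    qinv * Y (suc m) + qinv * Y m       ≈⟨ +-cong (qinv*Y (suc m)) (qinv*Y m) ⟩
    (- (qint (+ suc m ⊖ℤ + 1) * b (suc m))) - qint (+ m ⊖ℤ + 1) * b m
      ≈⟨ reflexive (≡.cong₂ (λ i j → (- (qint (+ suc m ⊖ℤ + 1) * b (suc m))) - qint i * bℤ j)
                            (ℤ.[1+m]⊖[1+n]≡m⊖n m 1) (suc-minus-one m)) ⟨
    (- (qint (+ suc m ⊖ℤ + 1) * b (suc m))) - qint (+ suc m ⊖ℤ + 2) * bℤ (+ suc m ⊖ℤ + 1) ∎

  theorem : ∀ n → sumTo (λ k → qpowℤ (+ k ⊖ℤ + 1) * b k * bℤ (+ n ⊖ℤ + k)) n
                ≈ (- (qint (+ n ⊖ℤ + 1) * b n)) - qint (+ n ⊖ℤ + 2) * bℤ (+ n ⊖ℤ + 1)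
  theorem n = begin
    sumTo (λ k → qpowℤ (+ k ⊖ℤ + 1) * b k * bℤ (+ n ⊖ℤ + k)) n  ≈⟨ lhs≈qinv*X n ⟩
    qinv * X n                                                   ≈⟨ *-congˡ (X≐T⋆Y n) ⟩
    qinv * (T ⋆ Y) n                                             ≈⟨ qinv*T⋆Y n ⟩
    (- (qint (+ n ⊖ℤ + 1) * b n)) - qint (+ n ⊖ℤ + 2) * bℤ (+ n ⊖ℤ + 1) ∎

theorem2 : {c ℓ : Level} (R : CommutativeRing c ℓ)
    (q qinv : CommutativeRing.Carrier R) (inv : ℕ → CommutativeRing.Carrier R) →
    CommutativeRing._≈_ R (CommutativeRing._*_ R q qinv) (CommutativeRing.1# R) →
    (∀ m → CommutativeRing._≈_ R (CommutativeRing._*_ R (QBernoulli.qnat R q qinv inv (suc m)) (inv m)) (CommutativeRing.1# R)) →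
    (n : ℕ) →
    let open CommutativeRing R
        open QBernoulli R q qinv inv
    in sumTo (λ k → qpowℤ (+ k ⊖ℤ + 1) * b k * bℤ (+ n ⊖ℤ + k)) n
       ≈ (- (qint (+ n ⊖ℤ + 1) * b n)) - qint (+ n ⊖ℤ + 2) * bℤ (+ n ⊖ℤ + 1)
theorem2 R q qinv inv q*qinv≈1 inv-correct = Bernoulli.theorem R q qinv inv q*qinv≈1 inv-correct
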